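{- For $n\ge1$ let $\mathcal C_n(p)=C_{n,p}/(n\,(2n-1)!!)$, where $C_{n,p}$ is the number of configurations of size $n$ in which exactly $p$ other pairs are contained by the given pair. Then for every integer $m\ge0$, $$\sum_{p=0}^{n-1}\frac{p!}{(p-m)!}\,\mathcal C_n(p)=\frac{(n-1)!}{(n-m-1)!}\,\frac{1}{(m+1)(2m+1)}.$$ In particular, if $C$ is a random variable with distribution $\mathcal C_n$, then $E(C)=(n-1)/6$ and $\mathrm{Var}(C)=(n-1)(7n+11)/180$.
   Context: Fix $n\ge1$. A configuration (of size $n$) is a perfect matching of the $2n$ points $1,2,\dots,2n$ (laid out on a line) into $n$ unordered pairs, together with one distinguished pair, called the given pair; the other $n-1$ pairs are treated as indistinguishable, so there are $n\,(2n-1)!!$ configurations. Let the given pair be $\{g<h\}$; another pair $\{a<b\}$ is contained by the given pair if $g<a<b<h$. Terms with $p<m$ in the sum are zero, and $\frac{(n-1)!}{(n-m-1)!}$ is interpreted as $0$ when $m>n-1$. -}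

module Defs where

open import Data.Nat as ℕ using (ℕ; zero; suc; _+_; _*_; _∸_; _<ᵇ_; _≡ᵇ_; NonZero)
open import Data.Nat.Properties using (m*n≢0)
open import Data.Nat.Combinatorics using (_P_)
open import Data.Bool using (Bool; true; false; _∧_; if_then_else_)
open import Data.Product using (_×_; _,_)
open import Data.List using (List; []; _∷_; map; concatMap; length; filterᵇ; upTo; foldr)
open import Data.Integer using (+_)
open import Data.Rational as ℚ using (ℚ; _/_; 0ℚ)

-- Perfect matchings of the points 1,…,2n, enumerated explicitly.
-- A pair is written (a , b) with a < b.

-- every element of a list together with the list of the remaining elements
-- that come after it (the elements before it are not needed: we always pair
-- the smallest remaining point x with a later point y)
picks : List ℕ → List (ℕ × List ℕ)
picks []       = []
picks (y ∷ ys) = (y , ys) ∷ map (λ { (z , zs) → (z , y ∷ zs) }) (picks ys)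

-- all perfect matchings of a sorted list of 2k points (each exactly once):
-- the smallest point x is paired with some other point y, and the rest is
-- matched recursively.  (Lists of the wrong length give no matchings.)
matchingsOf : ℕ → List ℕ → List (List (ℕ × ℕ))
matchingsOf zero    []       = [] ∷ []
matchingsOf zero    (_ ∷ _)  = []
matchingsOf (suc k) []       = []
matchingsOf (suc k) (x ∷ xs) =
  concatMap (λ { (y , rest) → map ((x , y) ∷_) (matchingsOf k rest) }) (picks xs)

points : ℕ → List ℕ
points n = map suc (upTo (2 * n))

matchings : ℕ → List (List (ℕ × ℕ))
matchings n = matchingsOf n (points n)

-- a configuration: a matching together with its distinguished (given) pair
Configuration : Set
Configuration = List (ℕ × ℕ) × (ℕ × ℕ)

configurations : ℕ → List Configuration
configurations n = concatMap (λ M → map (λ gp → (M , gp)) M) (matchings n)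

containedᵇ : ℕ × ℕ → ℕ × ℕ → Bool
containedᵇ (g , h) (a , b) = (g <ᵇ a) ∧ (b <ᵇ h)

-- number of other pairs contained by the given pair
-- (the given pair never contains itself, so we may count over all pairs)
containedCount : Configuration → ℕ
containedCount (M , gp) = length (filterᵇ (containedᵇ gp) M)

C : ℕ → ℕ → ℕ
C n p = length (filterᵇ (λ c → containedCount c ≡ᵇ p) (configurations n))

_!! : ℕ → ℕ
zero !!          = 1
suc zero !!      = 1
suc (suc k) !!   = suc (suc k) * (k !!)

dfact≢0 : ∀ k → NonZero (k !!)
dfact≢0 zero          = _
dfact≢0 (suc zero)    = _
dfact≢0 (suc (suc k)) = m*n≢0 (suc (suc k)) (k !!) {{_}} {{dfact≢0 k}}

total : ℕ → ℕ
total n = n * ((2 * n ∸ 1) !!)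

𝒞 : (n : ℕ) → .{{NonZero n}} → ℕ → ℚ
𝒞 n {{nz}} p = (+ C n p) / total n
  where instance _ = m*n≢0 n ((2 * n ∸ 1) !!) {{nz}} {{dfact≢0 (2 * n ∸ 1)}}

Σ< : ℕ → (ℕ → ℚ) → ℚ
Σ< n f = foldr (λ p acc → f p ℚ.+ acc) 0ℚ (upTo n)

-- falling factorial p!/(p-m)!  (library _P_, which is 0 when m > p)
ff : ℕ → ℕ → ℚ
ff p m = + (p P m) / 1

mean : (n : ℕ) → .{{NonZero n}} → ℚ
mean n = Σ< n (λ p → (+ p / 1) ℚ.* 𝒞 n p)

variance : (n : ℕ) → .{{NonZero n}} → ℚ
variance n = Σ< n (λ p → ((+ p / 1) ℚ.- mean n) ℚ.* ((+ p / 1) ℚ.- mean n) ℚ.* 𝒞 n p)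

module Submission where

-- The heart is an identity over ℕ (configMoment-formula): for an increasing
-- list L of 2k points,
--   (m+1)(2m+1) ∑_{matchings M of L} ∑_{G ∈ M} (#pairs of M contained by G)_m
--     = (2k-1)!! (k)_(m+1),
-- by induction on k, splitting off the pair (x , y) of the smallest point x.
-- As given pair, (x , y) contains the pairs inside the interval (x , y), whose
-- factorial moments come from a second induction (insideMoment-formula);
-- summing over y is the hockey-stick identity.  Otherwise (x , y) is contained
-- by nothing and the rest recurses.

open import Defs
open import Data.Nat as ℕ using (ℕ; zero; suc; pred; _+_; _*_; _∸_; _^_; _≤_; _<_; z≤n; s≤s; NonZero; _<ᵇ_; _≡ᵇ_)
open import Data.Nat.Properties
open import Data.Nat.Tactic.RingSolver using (solve-∀)
open import Algebra.Properties.CommutativeSemigroup +-commutativeSemigroup using (x∙yz≈y∙xz)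
open import Data.Nat.Combinatorics using (_P_; nP1≡n)
open import Data.Nat.Combinatorics.Base using (_P′_)
open import Data.Bool using (Bool; true; false; T; _∧_; not)
open import Data.Product using (_×_; _,_; proj₁; proj₂)
open import Data.List using (List; []; _∷_; map; concatMap; length; filterᵇ; _++_; upTo; applyUpTo; foldr)
open import Data.List.Properties using (map-∘; length-map; length-upTo)
open import Data.List.Relation.Unary.All as All using (All; []; _∷_)
import Data.List.Relation.Unary.All.Properties as All
open import Data.List.Relation.Unary.Any as Any using (Any; here; there)
open import Data.List.Membership.Propositional using (_∈_)
open import Data.List.Relation.Unary.AllPairs as AllPairs using (AllPairs; []; _∷_)
import Data.List.Relation.Unary.AllPairs.Properties as AllPairs
open import Function using (Equivalence) renaming (_∘′_ to _∘_)
open import Data.Bool.Properties using (T-≡; ¬-not; ∧-zeroʳ)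
open import Relation.Binary.PropositionalEquality
open import Relation.Nullary using (yes; no)
open ≡-Reasoning

fall : ℕ → ℕ → ℕ
fall a       zero    = 1
fall zero    (suc j) = 0
fall (suc a) (suc j) = suc a * fall a j

fall-pascal : ∀ a j → fall (suc a) (suc j) ≡ fall a (suc j) + suc j * fall a j
fall-pascal zero    zero    = refl
fall-pascal zero    (suc j) = sym (*-zeroʳ (suc (suc j)))
fall-pascal (suc a) zero    = base a
  where
  base : ∀ a → suc (suc a) * 1 ≡ suc a * 1 + 1 * 1
  base = solve-∀
fall-pascal (suc a) (suc j) = begin
  suc (suc a) * (suc a * fall a j)
    ≡⟨ expand (suc a) (fall a j) ⟩
  suc a * (suc a * fall a j) + suc a * fall a j
    ≡⟨ cong (λ t → suc a * t + suc a * fall a j) (fall-pascal a j) ⟩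
  suc a * (fall a (suc j) + suc j * fall a j) + suc a * fall a j
    ≡⟨ regroup (suc a) (suc j) (fall a j) (fall a (suc j)) ⟩
  suc a * fall a (suc j) + suc (suc j) * (suc a * fall a j)
    ∎
  where
  expand : ∀ b f → suc b * (b * f) ≡ b * (b * f) + b * f
  expand = solve-∀
  regroup : ∀ b i f g → b * (g + i * f) + b * f ≡ b * g + suc i * (b * f)
  regroup = solve-∀

fall-peel : ∀ a j → a * fall (pred a) j ≡ fall a (suc j)
fall-peel zero    j = refl
fall-peel (suc a) j = refl

fall-last : ∀ a j → fall a (suc j) ≡ fall a j * (a ∸ j)
fall-last zero    zero    = refl
fall-last zero    (suc j) = refl
fall-last (suc a) zero    = *-comm (suc a) 1
fall-last (suc a) (suc j) = begin
  suc a * fall a (suc j)       ≡⟨ cong (suc a *_) (fall-last a j) ⟩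
  suc a * (fall a j * (a ∸ j)) ≡⟨ *-assoc (suc a) (fall a j) (a ∸ j) ⟨
  suc a * fall a j * (a ∸ j)   ∎

fall-vanish : ∀ {a j} → a < j → fall a j ≡ 0
fall-vanish {zero}  {suc j} _         = refl
fall-vanish {suc a} {suc j} (s≤s a<j) = trans (cong (suc a *_) (fall-vanish a<j)) (*-zeroʳ (suc a))

fall-*-cong : ∀ a j {x y} → (j ≤ a → x ≡ y) → fall a j * x ≡ fall a j * y
fall-*-cong a j {x} {y} eq with j ≤? a
... | yes j≤a = cong (fall a j *_) (eq j≤a)
... | no  j≰a = begin
  fall a j * x ≡⟨ cong (_* x) (fall-vanish (≰⇒> j≰a)) ⟩
  0            ≡⟨ cong (_* y) (fall-vanish (≰⇒> j≰a)) ⟨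
  fall a j * y ∎

P′≡fall : ∀ p m → m ≤ p → p P′ m ≡ fall p m
P′≡fall p zero    _   = refl
P′≡fall p (suc m) m<p = begin
  (p ∸ m) * (p P′ m)   ≡⟨ cong ((p ∸ m) *_) (P′≡fall p m (<⇒≤ m<p)) ⟩
  (p ∸ m) * fall p m   ≡⟨ *-comm (p ∸ m) (fall p m) ⟩
  fall p m * (p ∸ m)   ≡⟨ fall-last p m ⟨
  fall p (suc m)       ∎

P≡fall : ∀ p m → p P m ≡ fall p m
P≡fall p m with m ℕ.≤ᵇ p in eq
... | true  = P′≡fall p m (≤ᵇ⇒≤ m p (subst T (sym eq) _))
... | false = sym (fall-vanish {p} {m} (≰⇒> λ m≤p → subst T eq (≤⇒≤ᵇ m≤p)))

-- (2k-1)!! = 1·3⋯(2k-1), the number of perfect matchings of 2k points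
oddFact : ℕ → ℕ
oddFact zero    = 1
oddFact (suc k) = suc (2 * k) * oddFact k

-- 2(k+1) in the form reached by pattern matching
double-suc : ∀ k → 2 * suc k ≡ suc (suc (2 * k))
double-suc k = *-suc 2 k

oddFact≡!! : ∀ n → (2 * n ∸ 1) !! ≡ oddFact n
oddFact≡!! zero    = refl
oddFact≡!! (suc k) = begin
  (2 * suc k ∸ 1) !!     ≡⟨ cong (λ t → (t ∸ 1) !!) (double-suc k) ⟩
  suc (2 * k) !!         ≡⟨ odd k ⟩
  oddFact (suc k)        ∎
  where
  odd : ∀ k → suc (2 * k) !! ≡ oddFact (suc k)
  odd zero    = refl
  odd (suc k) = begin
    suc (2 * suc k) !!                 ≡⟨ cong (λ t → suc t !!) (double-suc k) ⟩
    suc (suc (suc (2 * k))) * (suc (2 * k) !!)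
                                       ≡⟨ cong (suc (suc (suc (2 * k))) *_) (odd k) ⟩
    suc (suc (suc (2 * k))) * oddFact (suc k)
                                       ≡⟨ cong (λ t → suc t * oddFact (suc k)) (double-suc k) ⟨
    oddFact (suc (suc k))              ∎

sumBelow : ℕ → (ℕ → ℕ) → ℕ
sumBelow zero    g = 0
sumBelow (suc n) g = g 0 + sumBelow n (g ∘ suc)

sumBelow-snoc : ∀ n g → sumBelow (suc n) g ≡ sumBelow n g + g n
sumBelow-snoc zero    g = +-comm (g 0) 0
sumBelow-snoc (suc n) g = begin
  g 0 + sumBelow (suc n) (g ∘ suc)       ≡⟨ cong (g 0 +_) (sumBelow-snoc n (g ∘ suc)) ⟩
  g 0 + (sumBelow n (g ∘ suc) + g (suc n)) ≡⟨ +-assoc (g 0) _ _ ⟨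
  sumBelow (suc n) g + g (suc n)         ∎

sumBelow-affine : ∀ n a b g → sumBelow n (λ i → a * g i + b) ≡ a * sumBelow n g + n * b
sumBelow-affine zero    a b g = sym (trans (+-identityʳ (a * 0)) (*-zeroʳ a))
sumBelow-affine (suc n) a b g = begin
  a * g 0 + b + sumBelow n (λ i → a * g (suc i) + b)
    ≡⟨ cong (a * g 0 + b +_) (sumBelow-affine n a b (g ∘ suc)) ⟩
  a * g 0 + b + (a * sumBelow n (g ∘ suc) + n * b)
    ≡⟨ regroup a (g 0) b (sumBelow n (g ∘ suc)) n ⟩
  a * sumBelow (suc n) g + suc n * b
    ∎
  where
  regroup : ∀ a x b s n → a * x + b + (a * s + n * b) ≡ a * (x + s) + suc n * b
  regroup = solve-∀

hockeyStick : ∀ N j → suc j * sumBelow N (λ i → fall i j) ≡ fall N (suc j)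
hockeyStick zero    j = *-zeroʳ (suc j)
hockeyStick (suc N) j = begin
  suc j * sumBelow (suc N) (λ i → fall i j)
    ≡⟨ cong (suc j *_) (sumBelow-snoc N (λ i → fall i j)) ⟩
  suc j * (sumBelow N (λ i → fall i j) + fall N j)
    ≡⟨ *-distribˡ-+ (suc j) _ (fall N j) ⟩
  suc j * sumBelow N (λ i → fall i j) + suc j * fall N j
    ≡⟨ cong (_+ suc j * fall N j) (hockeyStick N j) ⟩
  fall N (suc j) + suc j * fall N j
    ≡⟨ fall-pascal N j ⟨
  fall (suc N) (suc j)
    ∎

-- If a set I holds a of 2k
-- points, the sum over all matchings of (number of pairs inside I)_m is this
-- weight divided by 2^m: m ordered pairs inside I are 2m ordered points of I
-- up to swapping within each pair, and the other 2(k-m) points are matched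
-- freely (insideMoment-formula).
pairedWeight : ℕ → ℕ → ℕ → ℕ
pairedWeight k a m = fall a (2 * m) * oddFact (k ∸ m)

half-≤ : ∀ m k → 2 * m ≤ suc (2 * k) → m ≤ k
half-≤ m k 2m≤ = ≤-pred (*-cancelˡ-< 2 m (suc k) (s≤s (≤-trans 2m≤ (≤-reflexive (sym (cong pred (double-suc k)))))))

-- the counting behind adding two points: if 2m of the a points of I are
-- used, then a - 2m + b = 2(k-m) + 1 points are left for the new point
oddFact-step : ∀ a b k m → 2 * m ≤ a → a + b ≡ suc (2 * k) →
               (a ∸ 2 * m + b) * oddFact (k ∸ m) ≡ oddFact (suc k ∸ m)
oddFact-step a b k m 2m≤a a+b = begin
  (a ∸ 2 * m + b) * oddFact (k ∸ m) ≡⟨ cong (_* oddFact (k ∸ m)) left ⟩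
  oddFact (suc (k ∸ m))             ≡⟨ cong oddFact (+-∸-assoc 1 m≤k) ⟨
  oddFact (suc k ∸ m)               ∎
  where
  m≤k : m ≤ k
  m≤k = half-≤ m k (≤-trans 2m≤a (≤-trans (m≤m+n a b) (≤-reflexive a+b)))
  left : a ∸ 2 * m + b ≡ suc (2 * (k ∸ m))
  left = begin
    a ∸ 2 * m + b       ≡⟨ +-∸-comm b 2m≤a ⟨
    (a + b) ∸ 2 * m     ≡⟨ cong (_∸ 2 * m) a+b ⟩
    suc (2 * k) ∸ 2 * m ≡⟨ +-∸-assoc 1 (*-monoʳ-≤ 2 m≤k) ⟩
    suc (2 * k ∸ 2 * m) ≡⟨ cong suc (*-distribˡ-∸ 2 k m) ⟨
    suc (2 * (k ∸ m))   ∎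

-- Matching 2k+2 points whose first point lies outside I, where the other
-- 2k+1 points contain a points of I and b outside it: the first point is
-- paired with a point of I (a ways) or outside I (b ways), and no pair
-- inside I is created.
weight-outside : ∀ a b k m → a + b ≡ suc (2 * k) →
  a * pairedWeight k (pred a) m + b * pairedWeight k a m ≡ pairedWeight (suc k) a m
weight-outside a b k m a+b = begin
  a * (fall (pred a) (2 * m) * t) + b * (fall a (2 * m) * t)
    ≡⟨ cong (_+ b * (fall a (2 * m) * t)) (*-assoc a _ t) ⟨
  a * fall (pred a) (2 * m) * t + b * (fall a (2 * m) * t)
    ≡⟨ cong (λ u → u * t + b * (fall a (2 * m) * t)) (trans (fall-peel a (2 * m)) (fall-last a (2 * m))) ⟩
  fall a (2 * m) * (a ∸ 2 * m) * t + b * (fall a (2 * m) * t)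
    ≡⟨ regroup (fall a (2 * m)) (a ∸ 2 * m) b t ⟩
  fall a (2 * m) * ((a ∸ 2 * m + b) * t)
    ≡⟨ fall-*-cong a (2 * m) (λ 2m≤a → oddFact-step a b k m 2m≤a a+b) ⟩
  fall a (2 * m) * oddFact (suc k ∸ m)
    ∎
  where
  t = oddFact (k ∸ m)
  regroup : ∀ f c b t → f * c * t + b * (f * t) ≡ f * ((c + b) * t)
  regroup = solve-∀

-- the extra contribution when the first pair itself lies inside I:
-- by Pascal, (P+1)_m = (P)_m + m (P)_(m-1)
extraWeight : ℕ → ℕ → ℕ → ℕ
extraWeight k zero    a = 0
extraWeight k (suc m) a = 2 * suc m * pairedWeight k a m

-- as weight-outside, but now the first point belongs to I
weight-inside : ∀ a b k m → a + b ≡ suc (2 * k) →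
  a * (pairedWeight k (pred a) m + extraWeight k m (pred a)) + b * pairedWeight k a m
    ≡ pairedWeight (suc k) (suc a) m
weight-inside a b k zero    a+b =
  trans (cong (λ u → a * u + b * pairedWeight k a 0) (+-identityʳ _)) (weight-outside a b k 0 a+b)
weight-inside a b k (suc m) a+b = begin
  a * (pairedWeight k (pred a) (suc m) + c * (fall (pred a) (2 * m) * t)) + b * pairedWeight k a (suc m)
    ≡⟨ regroup a (pairedWeight k (pred a) (suc m)) c (fall (pred a) (2 * m)) t (b * pairedWeight k a (suc m)) ⟩
  (a * pairedWeight k (pred a) (suc m) + b * pairedWeight k a (suc m)) + c * (a * fall (pred a) (2 * m)) * t
    ≡⟨ cong₂ (λ u v → u + c * v * t) (weight-outside a b k (suc m) a+b) (fall-peel a (2 * m)) ⟩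
  fall a c * t + c * fall a (suc (2 * m)) * t
    ≡⟨ *-distribʳ-+ t (fall a c) _ ⟨
  (fall a c + c * fall a (suc (2 * m))) * t
    ≡⟨ cong (_* t) pascal ⟨
  fall (suc a) c * t
    ∎
  where
  c = 2 * suc m
  t = oddFact (k ∸ m)
  regroup : ∀ a X c Y t W → a * (X + c * (Y * t)) + W ≡ (a * X + W) + c * (a * Y) * t
  regroup = solve-∀
  pascal : fall (suc a) c ≡ fall a c + c * fall a (suc (2 * m))
  pascal = begin
    fall (suc a) c                                         ≡⟨ cong (fall (suc a)) (double-suc m) ⟩
    fall (suc a) (suc (suc (2 * m)))                       ≡⟨ fall-pascal a (suc (2 * m)) ⟩
    fall a (suc (suc (2 * m))) + suc (suc (2 * m)) * fall a (suc (2 * m))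
                                                           ≡⟨ cong (λ u → fall a u + u * fall a (suc (2 * m))) (double-suc m) ⟨
    fall a c + c * fall a (suc (2 * m))                    ∎

weight-full : ∀ k m → pairedWeight k (2 * k) m ≡ 2 ^ m * fall k m * oddFact k
weight-full k       zero    = refl
weight-full zero    (suc m) = sym (cong (_* 1) (*-zeroʳ (2 ^ suc m)))
weight-full (suc k) (suc m) = begin
  fall (2 * suc k) (2 * suc m) * oddFact (k ∸ m)
    ≡⟨ cong₂ (λ u v → fall u v * oddFact (k ∸ m)) (double-suc k) (double-suc m) ⟩
  suc (suc (2 * k)) * (suc (2 * k) * fall (2 * k) (2 * m)) * oddFact (k ∸ m)
    ≡⟨ regroup (2 * k) (fall (2 * k) (2 * m)) (oddFact (k ∸ m)) ⟩
  suc (suc (2 * k)) * suc (2 * k) * pairedWeight k (2 * k) m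
    ≡⟨ cong (suc (suc (2 * k)) * suc (2 * k) *_) (weight-full k m) ⟩
  suc (suc (2 * k)) * suc (2 * k) * (2 ^ m * fall k m * oddFact k)
    ≡⟨ regroup′ k (2 ^ m) (fall k m) (oddFact k) ⟩
  2 ^ suc m * fall (suc k) (suc m) * oddFact (suc k)
    ∎
  where
  regroup : ∀ a f t → suc (suc a) * (suc a * f) * t ≡ suc (suc a) * suc a * (f * t)
  regroup = solve-∀
  regroup′ : ∀ k p f t → suc (suc (2 * k)) * suc (2 * k) * (p * f * t)
                       ≡ 2 * p * (suc k * f) * (suc (2 * k) * t)
  regroup′ = solve-∀

-- The recursion step of the main moment identity: the contributions of a
-- given pair that is the first pair (summed over its partner, by the
-- hockey stick) and of a given pair among the remaining ones add up to
-- the claimed value for k+1.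
momentStep : ∀ k m →
  suc m * suc (2 * m) * (oddFact (k ∸ m) * sumBelow (suc (2 * k)) (λ i → fall i (2 * m)))
    + suc (2 * k) * (2 ^ m * (oddFact k * fall k (suc m)))
  ≡ 2 ^ m * (oddFact (suc k) * fall (suc k) (suc m))
momentStep k m = begin
  suc m * suc (2 * m) * (t * S) + suc (2 * k) * b
    ≡⟨ cong (_+ suc (2 * k) * b) (regroup (suc m) (suc (2 * m)) t S) ⟩
  suc m * t * (suc (2 * m) * S) + suc (2 * k) * b
    ≡⟨ cong (λ u → suc m * t * u + suc (2 * k) * b) (hockeyStick (suc (2 * k)) (2 * m)) ⟩
  suc m * t * (suc (2 * k) * fall (2 * k) (2 * m)) + suc (2 * k) * b
    ≡⟨ cong (_+ suc (2 * k) * b) (regroup′ (suc m) t (suc (2 * k)) (fall (2 * k) (2 * m))) ⟩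
  suc m * suc (2 * k) * pairedWeight k (2 * k) m + suc (2 * k) * b
    ≡⟨ cong (λ u → suc m * suc (2 * k) * u + suc (2 * k) * b) (weight-full k m) ⟩
  suc m * suc (2 * k) * (2 ^ m * fall k m * oddFact k) + suc (2 * k) * b
    ≡⟨ regroup″ m k (2 ^ m) (fall k m) (oddFact k) (fall k (suc m)) ⟩
  2 ^ m * (oddFact (suc k) * (fall k (suc m) + suc m * fall k m))
    ≡⟨ cong (λ u → 2 ^ m * (oddFact (suc k) * u)) (fall-pascal k m) ⟨
  2 ^ m * (oddFact (suc k) * fall (suc k) (suc m))
    ∎
  where
  t = oddFact (k ∸ m)
  S = sumBelow (suc (2 * k)) (λ i → fall i (2 * m))
  b = 2 ^ m * (oddFact k * fall k (suc m))
  regroup : ∀ a c t s → a * c * (t * s) ≡ a * t * (c * s)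
  regroup = solve-∀
  regroup′ : ∀ a t c f → a * t * (c * f) ≡ a * c * (f * t)
  regroup′ = solve-∀
  regroup″ : ∀ m k p f t g → suc m * suc (2 * k) * (p * f * t) + suc (2 * k) * (p * (t * g))
                           ≡ p * (suc (2 * k) * t * (g + suc m * f))
  regroup″ = solve-∀

sumOver : {A : Set} → List A → (A → ℕ) → ℕ
sumOver []       f = 0
sumOver (x ∷ xs) f = f x + sumOver xs f

sumOver-++ : {A : Set} (xs ys : List A) (f : A → ℕ) → sumOver (xs ++ ys) f ≡ sumOver xs f + sumOver ys f
sumOver-++ []       ys f = refl
sumOver-++ (x ∷ xs) ys f = trans (cong (f x +_) (sumOver-++ xs ys f)) (sym (+-assoc (f x) _ _))

sumOver-map : {A B : Set} (g : A → B) (xs : List A) (f : B → ℕ) → sumOver (map g xs) f ≡ sumOver xs (f ∘ g)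
sumOver-map g []       f = refl
sumOver-map g (x ∷ xs) f = cong (f (g x) +_) (sumOver-map g xs f)

sumOver-concatMap : {A B : Set} (g : A → List B) (xs : List A) (f : B → ℕ) →
                    sumOver (concatMap g xs) f ≡ sumOver xs (λ a → sumOver (g a) f)
sumOver-concatMap g []       f = refl
sumOver-concatMap g (x ∷ xs) f =
  trans (sumOver-++ (g x) (concatMap g xs) f) (cong (sumOver (g x) f +_) (sumOver-concatMap g xs f))

sumOver-cong : {A : Set} {xs : List A} {f g : A → ℕ} → All (λ a → f a ≡ g a) xs → sumOver xs f ≡ sumOver xs g
sumOver-cong []       = refl
sumOver-cong (p ∷ ps) = cong₂ _+_ p (sumOver-cong ps)

sumOver-ext : {A : Set} (xs : List A) {f g : A → ℕ} → (∀ a → f a ≡ g a) → sumOver xs f ≡ sumOver xs g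
sumOver-ext xs eq = sumOver-cong (All.universal eq xs)

sumOver-scale : {A : Set} (c : ℕ) (xs : List A) (f : A → ℕ) → c * sumOver xs f ≡ sumOver xs (λ a → c * f a)
sumOver-scale c []       f = *-zeroʳ c
sumOver-scale c (x ∷ xs) f = trans (*-distribˡ-+ c (f x) _) (cong (c * f x +_) (sumOver-scale c xs f))

sumOver-+ : {A : Set} (xs : List A) (f g : A → ℕ) → sumOver xs (λ a → f a + g a) ≡ sumOver xs f + sumOver xs g
sumOver-+ []       f g = refl
sumOver-+ (x ∷ xs) f g = trans (cong (f x + g x +_) (sumOver-+ xs f g)) (swap (f x) (g x) (sumOver xs f) (sumOver xs g))
  where
  swap : ∀ a b c d → a + b + (c + d) ≡ a + c + (b + d)
  swap = solve-∀

sumOver-upTo : ∀ n g → sumOver (upTo n) g ≡ sumBelow n g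
sumOver-upTo n g = go n (λ i → i)
  where
  go : ∀ n f → sumOver (applyUpTo f n) g ≡ sumBelow n (g ∘ f)
  go zero    f = refl
  go (suc n) f = cong (g (f 0) +_) (go n (f ∘ suc))

count : {A : Set} → (A → Bool) → List A → ℕ
count p xs = length (filterᵇ p xs)

ind : Bool → ℕ
ind true  = 1
ind false = 0

count-cons : {A : Set} (p : A → Bool) (x : A) (xs : List A) → count p (x ∷ xs) ≡ ind (p x) + count p xs
count-cons p x xs with p x
... | true  = refl
... | false = refl

count-cong : {A : Set} {p q : A → Bool} (xs : List A) → All (λ a → p a ≡ q a) xs → count p xs ≡ count q xs
count-cong {p = p} {q} (x ∷ xs) (eq ∷ eqs) = begin
  count p (x ∷ xs)         ≡⟨ count-cons p x xs ⟩
  ind (p x) + count p xs   ≡⟨ cong₂ (λ b c → ind b + c) eq (count-cong xs eqs) ⟩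
  ind (q x) + count q xs   ≡⟨ count-cons q x xs ⟨
  count q (x ∷ xs)         ∎
count-cong []       []         = refl

count-none : {A : Set} {p : A → Bool} (xs : List A) → All (λ a → p a ≡ false) xs → count p xs ≡ 0
count-none {p = p} (x ∷ xs) (eq ∷ eqs) = trans (count-cons p x xs) (cong₂ (λ b c → ind b + c) eq (count-none xs eqs))
count-none []       []         = refl

count-≤ : {A : Set} (p : A → Bool) (xs : List A) → count p xs ≤ length xs
count-≤ p []       = z≤n
count-≤ p (x ∷ xs) with p x
... | true  = s≤s (count-≤ p xs)
... | false = m≤n⇒m≤1+n (count-≤ p xs)

count-split : {A : Set} (p : A → Bool) (xs : List A) → count p xs + count (λ a → not (p a)) xs ≡ length xs
count-split p []       = refl
count-split p (x ∷ xs) with p x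
... | true  = cong suc (count-split p xs)
... | false = trans (+-suc (count p xs) _) (cong suc (count-split p xs))

count-< : {A : Set} (p : A → Bool) (xs : List A) → Any (λ a → p a ≡ false) xs → count p xs < length xs
count-< p (x ∷ xs) (here px≡false) rewrite px≡false = s≤s (count-≤ p xs)
count-< p (x ∷ xs) (there fails) with p x
... | true  = s≤s (count-< p xs fails)
... | false = m<n⇒m<1+n (count-< p xs fails)

sumOver-bool : {A : Set} (I : A → Bool) (G : Bool → ℕ) (xs : List A) →
  sumOver xs (G ∘ I) ≡ count I xs * G true + count (λ a → not (I a)) xs * G false
sumOver-bool I G []       = refl
sumOver-bool I G (x ∷ xs) with I x
... | true  = trans (cong (G true +_) (sumOver-bool I G xs)) (sym (+-assoc (G true) _ _))
... | false = trans (cong (G false +_) (sumOver-bool I G xs))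
                    (x∙yz≈y∙xz (G false) (count I xs * G true) (count (λ a → not (I a)) xs * G false))

picks-chosen : (zs : List ℕ) → map proj₁ (picks zs) ≡ zs
picks-chosen []       = refl
picks-chosen (z ∷ zs) = cong (z ∷_) (trans (sym (map-∘ (picks zs))) (picks-chosen zs))

picks-length : (zs : List ℕ) → All (λ p → suc (length (proj₂ p)) ≡ length zs) (picks zs)
picks-length []       = []
picks-length (z ∷ zs) = refl ∷ All.map⁺ (All.map (cong suc) (picks-length zs))

picks-count : (I : ℕ → Bool) (zs : List ℕ) → All (λ p → ind (I (proj₁ p)) + count I (proj₂ p) ≡ count I zs) (picks zs)
picks-count I []       = []
picks-count I (z ∷ zs) = sym (count-cons I z zs) ∷ All.map⁺ (All.map (λ {p} eq → moved p eq) (picks-count I zs))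
  where
  moved : ∀ p → ind (I (proj₁ p)) + count I (proj₂ p) ≡ count I zs →
          ind (I (proj₁ p)) + count I (z ∷ proj₂ p) ≡ count I (z ∷ zs)
  moved (y , rest) eq = begin
    ind (I y) + count I (z ∷ rest)         ≡⟨ cong (ind (I y) +_) (count-cons I z rest) ⟩
    ind (I y) + (ind (I z) + count I rest) ≡⟨ x∙yz≈y∙xz (ind (I y)) (ind (I z)) (count I rest) ⟩
    ind (I z) + (ind (I y) + count I rest) ≡⟨ cong (ind (I z) +_) eq ⟩
    ind (I z) + count I zs                 ≡⟨ count-cons I z zs ⟨
    count I (z ∷ zs)                       ∎

picks-All : {Q : ℕ → Set} (zs : List ℕ) → All Q zs → All (λ p → Q (proj₁ p) × All Q (proj₂ p)) (picks zs)
picks-All []       []         = []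
picks-All (z ∷ zs) (pz ∷ pzs) = (pz , pzs) ∷ All.map⁺ (All.map (λ (py , prest) → py , pz ∷ prest) (picks-All zs pzs))

picks-sorted : (zs : List ℕ) → AllPairs _<_ zs → All (λ p → AllPairs _<_ (proj₂ p)) (picks zs)
picks-sorted []       []              = []
picks-sorted (z ∷ zs) (z<zs ∷ sorted) =
  sorted ∷ All.map⁺ (All.zipWith (λ ((_ , z<rest) , rest-sorted) → z<rest ∷ rest-sorted)
                                 (picks-All zs z<zs , picks-sorted zs sorted))

-- Summing over the choice of y from zs a quantity that depends only on
-- whether y lies in I and on how many of the remaining points lie in I:
-- y ∈ I happens for count I zs choices, each leaving one point of I fewer.
sumOver-picks : (I : ℕ → Bool) (F : Bool → ℕ → ℕ) (zs : List ℕ) →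
  sumOver (picks zs) (λ p → F (I (proj₁ p)) (count I (proj₂ p)))
    ≡ count I zs * F true (pred (count I zs)) + count (λ z → not (I z)) zs * F false (count I zs)
sumOver-picks I F zs = begin
  sumOver (picks zs) (λ p → F (I (proj₁ p)) (count I (proj₂ p)))
    ≡⟨ sumOver-cong (All.map (λ {p} → byChoice (I (proj₁ p)) (count I (proj₂ p))) (picks-count I zs)) ⟩
  sumOver (picks zs) (G ∘ I ∘ proj₁)
    ≡⟨ sumOver-map proj₁ (picks zs) (G ∘ I) ⟨
  sumOver (map proj₁ (picks zs)) (G ∘ I)
    ≡⟨ cong (λ ys → sumOver ys (G ∘ I)) (picks-chosen zs) ⟩
  sumOver zs (G ∘ I)
    ≡⟨ sumOver-bool I G zs ⟩
  count I zs * F true (pred (count I zs)) + count (λ z → not (I z)) zs * F false (count I zs)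
    ∎
  where
  G : Bool → ℕ
  G true  = F true (pred (count I zs))
  G false = F false (count I zs)
  byChoice : ∀ b c → ind b + c ≡ count I zs → F b c ≡ G b
  byChoice true  c eq = cong (F true ∘ pred) eq
  byChoice false c eq = cong (F false) eq

between : ℕ → ℕ → ℕ → Bool
between x y z = (x <ᵇ z) ∧ (z <ᵇ y)

<ᵇ-true : ∀ {m n} → m < n → (m <ᵇ n) ≡ true
<ᵇ-true m<n = Equivalence.to T-≡ (<⇒<ᵇ m<n)

<ᵇ-false : ∀ {m n} → n ≤ m → (m <ᵇ n) ≡ false
<ᵇ-false {m} {n} n≤m = ¬-not (λ m<ᵇn → <⇒≱ (<ᵇ⇒< m n (Equivalence.from T-≡ m<ᵇn)) n≤m)

-- If zs is increasing and lies above x, choosing its i-th element as y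
-- leaves exactly i of the remaining points between x and y.
sumOver-picks-between : ∀ x (zs : List ℕ) → AllPairs _<_ zs → All (x <_) zs → (g : ℕ → ℕ) →
  sumOver (picks zs) (λ p → g (count (between x (proj₁ p)) (proj₂ p))) ≡ sumBelow (length zs) g
sumOver-picks-between x []       []              []           g = refl
sumOver-picks-between x (z ∷ zs) (z<zs ∷ sorted) (x<z ∷ x<zs) g = begin
  g (count (between x z) zs) + sumOver (map addZ (picks zs)) h
    ≡⟨ cong₂ _+_ (cong g noneBelowZ) (sumOver-map addZ (picks zs) h) ⟩
  g 0 + sumOver (picks zs) (h ∘ addZ)
    ≡⟨ cong (g 0 +_) (sumOver-cong (All.map (λ {p} (z<y , _) → cong g (zBetween p z<y)) (picks-All zs z<zs))) ⟩
  g 0 + sumOver (picks zs) (λ p → g (suc (count (between x (proj₁ p)) (proj₂ p))))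
    ≡⟨ cong (g 0 +_) (sumOver-picks-between x zs sorted x<zs (g ∘ suc)) ⟩
  g 0 + sumBelow (length zs) (g ∘ suc)
    ∎
  where
  h : ℕ × List ℕ → ℕ
  h p = g (count (between x (proj₁ p)) (proj₂ p))
  addZ : ℕ × List ℕ → ℕ × List ℕ
  addZ (y , rest) = y , z ∷ rest
  noneBelowZ : count (between x z) zs ≡ 0
  noneBelowZ = count-none zs (All.map (λ {w} z<w → trans (cong ((x <ᵇ w) ∧_) (<ᵇ-false (<⇒≤ z<w)))
                                                          (∧-zeroʳ (x <ᵇ w))) z<zs)
  zBetween : ∀ p → z < proj₁ p →
             count (between x (proj₁ p)) (z ∷ proj₂ p) ≡ suc (count (between x (proj₁ p)) (proj₂ p))
  zBetween (y , rest) z<y = trans (count-cons (between x y) z rest)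
    (cong (λ b → ind b + count (between x y) rest) (cong₂ _∧_ (<ᵇ-true x<z) (<ᵇ-true z<y)))

sumOver-matchings : ∀ k x xs (F : List (ℕ × ℕ) → ℕ) →
  sumOver (matchingsOf (suc k) (x ∷ xs)) F
    ≡ sumOver (picks xs) (λ p → sumOver (matchingsOf k (proj₂ p)) (λ R → F ((x , proj₁ p) ∷ R)))
sumOver-matchings k x xs F =
  trans (sumOver-concatMap _ (picks xs) F)
        (sumOver-ext (picks xs) (λ p → sumOver-map ((x , proj₁ p) ∷_) (matchingsOf k (proj₂ p)) F))

matchings-length : ∀ k L → All (λ M → length M ≡ k) (matchingsOf k L)
matchings-length zero    []       = refl ∷ []
matchings-length zero    (_ ∷ _)  = []
matchings-length (suc k) []       = []
matchings-length (suc k) (x ∷ xs) =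
  All.concat⁺ (All.map⁺ (All.universal (λ p → All.map⁺ (All.map (cong suc) (matchings-length k (proj₂ p)))) (picks xs)))

matchings-All : (Inv : List ℕ → Set) {Q : ℕ × ℕ → Set} →
  (∀ {x xs} → Inv (x ∷ xs) → All (λ p → Q (x , proj₁ p) × Inv (proj₂ p)) (picks xs)) →
  ∀ k L → Inv L → All (All Q) (matchingsOf k L)
matchings-All Inv step zero    []       _   = [] ∷ []
matchings-All Inv step zero    (_ ∷ _)  _   = []
matchings-All Inv step (suc k) []       _   = []
matchings-All Inv step (suc k) (x ∷ xs) inv =
  All.concat⁺ (All.map⁺ (All.map (λ {p} (q , inv′) → All.map⁺ (All.map (q ∷_) (matchings-All Inv step k (proj₂ p) inv′)))
                                 (step inv)))

matchings-ordered : ∀ x k L → AllPairs _<_ L → All (x <_) L →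
  All (All (λ q → proj₁ q < proj₂ q × x < proj₁ q)) (matchingsOf k L)
matchings-ordered x k L sorted x<L = matchings-All Inv step k L (sorted , x<L)
  where
  Inv : List ℕ → Set
  Inv L = AllPairs _<_ L × All (x <_) L
  step : ∀ {z zs} → Inv (z ∷ zs) → All (λ p → (z < proj₁ p × x < z) × Inv (proj₂ p)) (picks zs)
  step {z} {zs} (z<zs ∷ sorted , x<z ∷ x<zs) =
    All.zipWith (λ (((z<y , _) , (_ , x<rest)) , rest-sorted) → (z<y , x<z) , rest-sorted , x<rest)
      (All.zip (picks-All zs z<zs , picks-All zs x<zs) , picks-sorted zs sorted)

insideᵇ : (ℕ → Bool) → ℕ × ℕ → Bool
insideᵇ I (a , b) = I a ∧ I b

insideMoment : ℕ → List ℕ → (ℕ → Bool) → ℕ → ℕ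
insideMoment k L I m = sumOver (matchingsOf k L) (λ R → fall (count (insideᵇ I) R) m)

-- the value of the moment above when the first pair adds b ∈ {0,1} pairs inside I
firstPairWeight : Bool → ℕ → ℕ → ℕ → ℕ
firstPairWeight false k a m = pairedWeight k a m
firstPairWeight true  k a m = pairedWeight k a m + extraWeight k m a

-- Adding the indicator b of the first pair to every count: given the moments
-- of P for all j, Pascal's rule (P+1)_(m+1) = (P)_(m+1) + (m+1) (P)_m yields
-- the moments of ind b + P.
shiftedMoment : {X : Set} (Rs : List X) (P : X → ℕ) (k a : ℕ) →
  (∀ j → 2 ^ j * sumOver Rs (λ R → fall (P R) j) ≡ pairedWeight k a j) →
  ∀ b m → 2 ^ m * sumOver Rs (λ R → fall (ind b + P R) m) ≡ firstPairWeight b k a m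
shiftedMoment Rs P k a moments false m       = moments m
shiftedMoment Rs P k a moments true  zero    = trans (moments 0) (sym (+-identityʳ _))
shiftedMoment Rs P k a moments true  (suc m) = begin
  2 ^ suc m * sumOver Rs (λ R → fall (suc (P R)) (suc m))
    ≡⟨ cong (2 ^ suc m *_) (sumOver-ext Rs (λ R → fall-pascal (P R) m)) ⟩
  2 ^ suc m * sumOver Rs (λ R → fall (P R) (suc m) + suc m * fall (P R) m)
    ≡⟨ cong (2 ^ suc m *_) (sumOver-+ Rs _ _) ⟩
  2 ^ suc m * (S (suc m) + sumOver Rs (λ R → suc m * fall (P R) m))
    ≡⟨ cong (λ u → 2 ^ suc m * (S (suc m) + u)) (sumOver-scale (suc m) Rs _) ⟨
  2 ^ suc m * (S (suc m) + suc m * S m)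
    ≡⟨ regroup (2 ^ m) (S (suc m)) m (S m) ⟩
  2 ^ suc m * S (suc m) + 2 * suc m * (2 ^ m * S m)
    ≡⟨ cong₂ (λ u v → u + 2 * suc m * v) (moments (suc m)) (moments m) ⟩
  pairedWeight k a (suc m) + 2 * suc m * pairedWeight k a m
    ∎
  where
  S : ℕ → ℕ
  S j = sumOver Rs (λ R → fall (P R) j)
  regroup : ∀ p s m t → 2 * p * (s + suc m * t) ≡ 2 * p * s + 2 * suc m * (p * t)
  regroup = solve-∀

weight-extend : ∀ bx a b k m → a + b ≡ suc (2 * k) →
  a * firstPairWeight (bx ∧ true) k (pred a) m + b * firstPairWeight (bx ∧ false) k a m
    ≡ pairedWeight (suc k) (ind bx + a) m
weight-extend false a b k m a+b = weight-outside a b k m a+b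
weight-extend true  a b k m a+b = weight-inside a b k m a+b

insideMoment-formula : ∀ k L I m → length L ≡ 2 * k → 2 ^ m * insideMoment k L I m ≡ pairedWeight k (count I L) m
insideMoment-formula zero    []       I zero    _ = refl
insideMoment-formula zero    []       I (suc m) _ = *-zeroʳ (2 ^ suc m)
insideMoment-formula (suc k) (x ∷ xs) I m len = begin
  2 ^ m * insideMoment (suc k) (x ∷ xs) I m
    ≡⟨ cong (2 ^ m *_) (sumOver-matchings k x xs _) ⟩
  2 ^ m * sumOver (picks xs) (λ p → sumOver (matchingsOf k (proj₂ p)) (λ R → fall (count (insideᵇ I) ((x , proj₁ p) ∷ R)) m))
    ≡⟨ sumOver-scale (2 ^ m) (picks xs) _ ⟩
  sumOver (picks xs) (λ p → 2 ^ m * sumOver (matchingsOf k (proj₂ p)) (λ R → fall (count (insideᵇ I) ((x , proj₁ p) ∷ R)) m))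
    ≡⟨ sumOver-cong (All.map (λ {p} eq → firstPair p (suc-injective (trans eq lenxs))) (picks-length xs)) ⟩
  sumOver (picks xs) (λ p → F (I (proj₁ p)) (count I (proj₂ p)))
    ≡⟨ sumOver-picks I F xs ⟩
  A * F true (pred A) + count (λ z → not (I z)) xs * F false A
    ≡⟨ weight-extend (I x) A _ k m (trans (count-split I xs) lenxs) ⟩
  pairedWeight (suc k) (ind (I x) + A) m
    ≡⟨ cong (λ a → pairedWeight (suc k) a m) (count-cons I x xs) ⟨
  pairedWeight (suc k) (count I (x ∷ xs)) m
    ∎
  where
  A = count I xs
  F : Bool → ℕ → ℕ
  F b a = firstPairWeight (I x ∧ b) k a m
  lenxs : length xs ≡ suc (2 * k)
  lenxs = suc-injective (trans len (double-suc k))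
  firstPair : ∀ p → length (proj₂ p) ≡ 2 * k →
    2 ^ m * sumOver (matchingsOf k (proj₂ p)) (λ R → fall (count (insideᵇ I) ((x , proj₁ p) ∷ R)) m)
      ≡ F (I (proj₁ p)) (count I (proj₂ p))
  firstPair (y , rest) len′ = begin
    2 ^ m * sumOver (matchingsOf k rest) (λ R → fall (count (insideᵇ I) ((x , y) ∷ R)) m)
      ≡⟨ cong (2 ^ m *_) (sumOver-ext (matchingsOf k rest) (λ R → cong (λ c → fall c m) (count-cons (insideᵇ I) (x , y) R))) ⟩
    2 ^ m * sumOver (matchingsOf k rest) (λ R → fall (ind (I x ∧ I y) + count (insideᵇ I) R) m)
      ≡⟨ shiftedMoment (matchingsOf k rest) (count (insideᵇ I)) k (count I rest)
           (λ j → insideMoment-formula k rest I j len′) (I x ∧ I y) m ⟩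
    F (I y) (count I rest)
      ∎

givenMoment : ℕ → List (ℕ × ℕ) → ℕ
givenMoment m M = sumOver M (λ G → fall (count (containedᵇ G) M) m)

configMoment : ℕ → List ℕ → ℕ → ℕ
configMoment k L m = sumOver (matchingsOf k L) (givenMoment m)

contained-self : ∀ G → containedᵇ G G ≡ false
contained-self (g , h) = cong (_∧ (h <ᵇ h)) (<ᵇ-false {g} ≤-refl)

contained-between : ∀ x y a b → a < b →
  containedᵇ (x , y) (a , b) ≡ ((x <ᵇ a) ∧ (a <ᵇ y)) ∧ ((x <ᵇ b) ∧ (b <ᵇ y))
contained-between x y a b a<b with x <ᵇ a in x<ᵇa | b <ᵇ y in b<ᵇy
... | false | _     = refl
... | true  | false = sym (trans (cong ((a <ᵇ y) ∧_) (∧-zeroʳ (x <ᵇ b))) (∧-zeroʳ (a <ᵇ y)))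
... | true  | true  = sym (cong₂ (λ u v → u ∧ (v ∧ true)) (<ᵇ-true (<-trans a<b b<y)) (<ᵇ-true (<-trans x<a a<b)))
  where
  x<a : x < a
  x<a = <ᵇ⇒< x a (Equivalence.from T-≡ x<ᵇa)
  b<y : b < y
  b<y = <ᵇ⇒< b y (Equivalence.from T-≡ b<ᵇy)

-- If x lies below every point of R, then as given pair (x , y) contains
-- exactly the pairs of R inside the interval (x , y), and the pair (x , y)
-- is contained by no pair of R.
givenMoment-cons : ∀ m x y R → All (λ q → proj₁ q < proj₂ q × x < proj₁ q) R →
  givenMoment m ((x , y) ∷ R) ≡ fall (count (insideᵇ (between x y)) R) m + givenMoment m R
givenMoment-cons m x y R ordered = cong₂ _+_ (cong (λ c → fall c m) asGiven) (sumOver-cong (All.map notContained ordered))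
  where
  asGiven : count (containedᵇ (x , y)) ((x , y) ∷ R) ≡ count (insideᵇ (between x y)) R
  asGiven = begin
    count (containedᵇ (x , y)) ((x , y) ∷ R)
      ≡⟨ count-cons (containedᵇ (x , y)) (x , y) R ⟩
    ind (containedᵇ (x , y) (x , y)) + count (containedᵇ (x , y)) R
      ≡⟨ cong (λ b → ind b + count (containedᵇ (x , y)) R) (contained-self (x , y)) ⟩
    count (containedᵇ (x , y)) R
      ≡⟨ count-cong R (All.map (λ {q} (a<b , _) → contained-between x y (proj₁ q) (proj₂ q) a<b) ordered) ⟩
    count (insideᵇ (between x y)) R
      ∎
  notContained : ∀ {G} → proj₁ G < proj₂ G × x < proj₁ G →
    fall (count (containedᵇ G) ((x , y) ∷ R)) m ≡ fall (count (containedᵇ G) R) m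
  notContained {g , h} (_ , x<g) =
    cong (λ c → fall c m) (trans (count-cons (containedᵇ (g , h)) (x , y) R)
                                 (cong (λ b → ind (b ∧ (y <ᵇ h)) + count (containedᵇ (g , h)) R) (<ᵇ-false (<⇒≤ x<g))))

-- Fixing the partner y of the smallest point x of the configuration: as
-- given pair, (x , y) contributes the inside moment of the interval (x , y);
-- otherwise the given pair is one of the rest.
configMoment-firstPair : ∀ k m x y ws → AllPairs _<_ ws → All (x <_) ws →
  sumOver (matchingsOf k ws) (λ R → givenMoment m ((x , y) ∷ R))
    ≡ insideMoment k ws (between x y) m + configMoment k ws m
configMoment-firstPair k m x y ws sorted x<ws =
  trans (sumOver-cong (All.map (givenMoment-cons m x y _) (matchings-ordered x k ws sorted x<ws)))
        (sumOver-+ (matchingsOf k ws) _ _)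

-- The main identity, for L increasing of 2k points:
--   (m+1)(2m+1) ∑_{configurations} (number of contained pairs)_m = (2k-1)!! (k)_(m+1)
-- (both sides multiplied by 2^m), by induction on k via configMoment-firstPair;
-- the partner y running through the rest, the interval (x , y) holds
-- 0, 1, …, 2k points, which momentStep sums by the hockey stick.
configMoment-formula : ∀ k L m → AllPairs _<_ L → length L ≡ 2 * k →
  suc m * suc (2 * m) * (2 ^ m * configMoment k L m) ≡ 2 ^ m * (oddFact k * fall k (suc m))
configMoment-formula zero    []       m _               _   =
  trans (cong (suc m * suc (2 * m) *_) (*-zeroʳ (2 ^ m))) (trans (*-zeroʳ (suc m * suc (2 * m))) (sym (*-zeroʳ (2 ^ m))))
configMoment-formula (suc k) (x ∷ xs) m (x<xs ∷ sorted) len = begin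
  c * (2 ^ m * configMoment (suc k) (x ∷ xs) m)
    ≡⟨ cong (λ u → c * (2 ^ m * u)) (sumOver-matchings k x xs (givenMoment m)) ⟩
  c * (2 ^ m * sumOver (picks xs) first)
    ≡⟨ trans (cong (c *_) (sumOver-scale (2 ^ m) (picks xs) first)) (sumOver-scale c (picks xs) _) ⟩
  sumOver (picks xs) (λ p → c * (2 ^ m * first p))
    ≡⟨ sumOver-cong (All.map (λ {p} ((_ , x<rest) , sorted′ , len′) →
                                 perPick p sorted′ x<rest (suc-injective (trans len′ lenxs))) pickFacts) ⟩
  sumOver (picks xs) (λ p → g (count (between x (proj₁ p)) (proj₂ p)))
    ≡⟨ sumOver-picks-between x xs sorted x<xs g ⟩
  sumBelow (length xs) g
    ≡⟨ cong (λ n → sumBelow n g) lenxs ⟩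
  sumBelow (suc (2 * k)) g
    ≡⟨ sumBelow-affine (suc (2 * k)) (c * oddFact (k ∸ m)) b (λ i → fall i (2 * m)) ⟩
  c * oddFact (k ∸ m) * sumBelow (suc (2 * k)) (λ i → fall i (2 * m)) + suc (2 * k) * b
    ≡⟨ cong (_+ suc (2 * k) * b) (*-assoc c (oddFact (k ∸ m)) _) ⟩
  c * (oddFact (k ∸ m) * sumBelow (suc (2 * k)) (λ i → fall i (2 * m))) + suc (2 * k) * b
    ≡⟨ momentStep k m ⟩
  2 ^ m * (oddFact (suc k) * fall (suc k) (suc m))
    ∎
  where
  c = suc m * suc (2 * m)
  b = 2 ^ m * (oddFact k * fall k (suc m))
  g : ℕ → ℕ
  g i = c * oddFact (k ∸ m) * fall i (2 * m) + b
  lenxs : length xs ≡ suc (2 * k)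
  lenxs = suc-injective (trans len (double-suc k))
  first : ℕ × List ℕ → ℕ
  first p = sumOver (matchingsOf k (proj₂ p)) (λ R → givenMoment m ((x , proj₁ p) ∷ R))
  pickFacts : All (λ p → (x < proj₁ p × All (x <_) (proj₂ p))
                          × AllPairs _<_ (proj₂ p) × suc (length (proj₂ p)) ≡ length xs) (picks xs)
  pickFacts = All.zip (picks-All xs x<xs , All.zip (picks-sorted xs sorted , picks-length xs))
  perPick : ∀ p → AllPairs _<_ (proj₂ p) → All (x <_) (proj₂ p) → length (proj₂ p) ≡ 2 * k →
            c * (2 ^ m * first p) ≡ g (count (between x (proj₁ p)) (proj₂ p))
  perPick (y , ws) sorted′ x<ws len′ = begin
    c * (2 ^ m * first (y , ws))
      ≡⟨ cong (λ u → c * (2 ^ m * u)) (configMoment-firstPair k m x y ws sorted′ x<ws) ⟩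
    c * (2 ^ m * (insideMoment k ws (between x y) m + configMoment k ws m))
      ≡⟨ distrib c (2 ^ m) (insideMoment k ws (between x y) m) (configMoment k ws m) ⟩
    c * (2 ^ m * insideMoment k ws (between x y) m) + c * (2 ^ m * configMoment k ws m)
      ≡⟨ cong₂ (λ u v → c * u + v) (insideMoment-formula k ws (between x y) m len′)
                                   (configMoment-formula k ws m sorted′ len′) ⟩
    c * pairedWeight k (count (between x y) ws) m + b
      ≡⟨ cong (_+ b) (regroup c (fall (count (between x y) ws) (2 * m)) (oddFact (k ∸ m))) ⟩
    g (count (between x y) ws)
      ∎
    where
    distrib : ∀ c p s t → c * (p * (s + t)) ≡ c * (p * s) + c * (p * t)
    distrib = solve-∀
    regroup : ∀ c f t → c * (f * t) ≡ c * t * f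
    regroup = solve-∀

sumBelow-zeros : ∀ n f → sumBelow n (λ p → f p * 0) ≡ 0
sumBelow-zeros zero    f = refl
sumBelow-zeros (suc n) f = cong₂ _+_ (*-zeroʳ (f 0)) (sumBelow-zeros n (f ∘ suc))

sumBelow-indicator : ∀ n q g → q < n → sumBelow n (λ p → g p * ind (q ≡ᵇ p)) ≡ g q
sumBelow-indicator (suc n) zero    g _         =
  trans (cong₂ _+_ (*-identityʳ (g 0)) (sumBelow-zeros n (g ∘ suc))) (+-identityʳ (g 0))
sumBelow-indicator (suc n) (suc q) g (s≤s q<n) =
  trans (cong (_+ sumBelow n (λ p → g (suc p) * ind (q ≡ᵇ p))) (*-zeroʳ (g 0)))
        (sumBelow-indicator n q (g ∘ suc) q<n)

sumOver-fibers : {A : Set} (n : ℕ) (g : ℕ → ℕ) (κ : A → ℕ) (cs : List A) → All (λ c → κ c < n) cs →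
  sumOver (upTo n) (λ p → g p * count (λ c → κ c ≡ᵇ p) cs) ≡ sumOver cs (g ∘ κ)
sumOver-fibers n g κ []       []           = trans (sumOver-upTo n (λ p → g p * 0)) (sumBelow-zeros n g)
sumOver-fibers n g κ (c ∷ cs) (κc<n ∷ κ<n) = begin
  sumOver (upTo n) (λ p → g p * count (λ c → κ c ≡ᵇ p) (c ∷ cs))
    ≡⟨ sumOver-ext (upTo n) (λ p → trans (cong (g p *_) (count-cons _ c cs)) (*-distribˡ-+ (g p) _ _)) ⟩
  sumOver (upTo n) (λ p → g p * ind (κ c ≡ᵇ p) + g p * count (λ c → κ c ≡ᵇ p) cs)
    ≡⟨ sumOver-+ (upTo n) _ _ ⟩
  sumOver (upTo n) (λ p → g p * ind (κ c ≡ᵇ p)) + sumOver (upTo n) (λ p → g p * count (λ c → κ c ≡ᵇ p) cs)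
    ≡⟨ cong₂ _+_ (trans (sumOver-upTo n _) (sumBelow-indicator n (κ c) g κc<n)) (sumOver-fibers n g κ cs κ<n) ⟩
  g (κ c) + sumOver cs (g ∘ κ)
    ∎

-- every matching of the 2n points has n pairs, and the given pair is not
-- contained by itself, so at most n-1 pairs are contained by it
configurations-bound : ∀ n → All (λ c → containedCount c < n) (configurations n)
configurations-bound n =
  All.concat⁺ (All.map⁺ (All.map (λ {M} lenM → All.map⁺ (All.tabulate (λ {G} G∈M → bound M G lenM G∈M)))
                                 (matchings-length n (points n))))
  where
  bound : ∀ M G → length M ≡ n → G ∈ M → count (containedᵇ G) M < n
  bound M G lenM G∈M = subst (count (containedᵇ G) M <_) lenM
    (count-< (containedᵇ G) M (Any.map (λ { refl → contained-self G }) G∈M))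

points-sorted : ∀ n → AllPairs _<_ (points n)
points-sorted n = AllPairs.map⁺ (AllPairs.applyUpTo⁺₁ (λ i → i) (2 * n) (λ i<j _ → s≤s i<j))

points-length : ∀ n → length (points n) ≡ 2 * n
points-length n = trans (length-map suc (upTo (2 * n))) (length-upTo (2 * n))

momentSum≡configMoment : ∀ n m → sumOver (upTo n) (λ p → (p P m) * C n p) ≡ configMoment n (points n) m
momentSum≡configMoment n m = begin
  sumOver (upTo n) (λ p → (p P m) * C n p)
    ≡⟨ sumOver-fibers n (_P m) containedCount (configurations n) (configurations-bound n) ⟩
  sumOver (configurations n) (λ c → containedCount c P m)
    ≡⟨ sumOver-ext (configurations n) (λ c → P≡fall (containedCount c) m) ⟩
  sumOver (configurations n) (λ c → fall (containedCount c) m)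
    ≡⟨ sumOver-concatMap _ (matchings n) _ ⟩
  sumOver (matchings n) (λ M → sumOver (map (M ,_) M) (λ c → fall (containedCount c) m))
    ≡⟨ sumOver-ext (matchings n) (λ M → sumOver-map (M ,_) M _) ⟩
  configMoment n (points n) m
    ∎

momentIdentity : ∀ k m → suc m * suc (2 * m) * sumOver (upTo (suc k)) (λ p → (p P m) * C (suc k) p)
                         ≡ total (suc k) * (k P m)
momentIdentity k m = begin
  c * sumOver (upTo n) (λ p → (p P m) * C n p)   ≡⟨ cong (c *_) (momentSum≡configMoment n m) ⟩
  c * configMoment n (points n) m                ≡⟨ *-cancelˡ-≡ _ _ (2 ^ m) {{m^n≢0 2 m}} scaled ⟩
  oddFact n * (n * fall k m)                     ≡⟨ regroup n (oddFact n) (fall k m) ⟩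
  n * oddFact n * fall k m                       ≡⟨ cong₂ (λ u v → n * u * v) (oddFact≡!! n) (P≡fall k m) ⟨
  total n * (k P m)                              ∎
  where
  n = suc k
  c = suc m * suc (2 * m)
  regroup : ∀ n t f → t * (n * f) ≡ n * t * f
  regroup = solve-∀
  swap : ∀ a c f → a * (c * f) ≡ c * (a * f)
  swap = solve-∀
  scaled : 2 ^ m * (c * configMoment n (points n) m) ≡ 2 ^ m * (oddFact n * fall n (suc m))
  scaled = trans (swap (2 ^ m) c _) (configMoment-formula n (points n) m (points-sorted n) (points-length n))

-- Passing to the rationals: sums of fractions (+ a) / T are computed in the
-- unnormalised rationals ℚᵘ, where fractions add and multiply without
-- normalisation.  (The integer sign +_ is opened only from here on, since it
-- would clash with the sections (x +_) of ℕ-addition used above.)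

open import Data.Integer as ℤ using (+_)
import Data.Integer.Properties as ℤ
open import Data.Rational as ℚ using (ℚ; _/_; 0ℚ; 1ℚ; fromℚᵘ)
import Data.Rational.Properties as ℚ
open import Data.Rational.Unnormalised as ℚᵘ using (mkℚᵘ; *≡*)
import Data.Rational.Unnormalised.Properties as ℚᵘ
open import Data.Rational.Solver using (module +-*-Solver)
open +-*-Solver using (solve; _:+_; _:-_; _:*_; _:=_; con)

fromℚᵘ-+ : ∀ p q → fromℚᵘ p ℚ.+ fromℚᵘ q ≡ fromℚᵘ (p ℚᵘ.+ q)
fromℚᵘ-+ p q = ℚ.toℚᵘ-injective (ℚᵘ.≃-trans (ℚ.toℚᵘ-homo-+ (fromℚᵘ p) (fromℚᵘ q))
  (ℚᵘ.≃-trans (ℚᵘ.+-cong (ℚ.toℚᵘ-fromℚᵘ p) (ℚ.toℚᵘ-fromℚᵘ q)) (ℚᵘ.≃-sym (ℚ.toℚᵘ-fromℚᵘ (p ℚᵘ.+ q)))))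

fromℚᵘ-* : ∀ p q → fromℚᵘ p ℚ.* fromℚᵘ q ≡ fromℚᵘ (p ℚᵘ.* q)
fromℚᵘ-* p q = ℚ.toℚᵘ-injective (ℚᵘ.≃-trans (ℚ.toℚᵘ-homo-* (fromℚᵘ p) (fromℚᵘ q))
  (ℚᵘ.≃-trans (ℚᵘ.*-cong (ℚ.toℚᵘ-fromℚᵘ p) (ℚ.toℚᵘ-fromℚᵘ q)) (ℚᵘ.≃-sym (ℚ.toℚᵘ-fromℚᵘ (p ℚᵘ.* q)))))

ι : ℕ → ℚ
ι a = + a / 1

ι-+ : ∀ a b → ι (a + b) ≡ ι a ℚ.+ ι b
ι-+ a b = trans (ℚ.fromℚᵘ-cong {mkℚᵘ (+ (a + b)) 0} {mkℚᵘ (+ a) 0 ℚᵘ.+ mkℚᵘ (+ b) 0} (*≡* (cong (ℤ._* + 1) numerators)))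
                (sym (fromℚᵘ-+ (mkℚᵘ (+ a) 0) (mkℚᵘ (+ b) 0)))
  where
  numerators : + (a + b) ≡ + a ℤ.* + 1 ℤ.+ + b ℤ.* + 1
  numerators = trans (ℤ.pos-+ a b) (sym (cong₂ ℤ._+_ (ℤ.*-identityʳ (+ a)) (ℤ.*-identityʳ (+ b))))

ι-* : ∀ a b → ι (a * b) ≡ ι a ℚ.* ι b
ι-* a b = trans (ℚ.fromℚᵘ-cong {mkℚᵘ (+ (a * b)) 0} {mkℚᵘ (+ a) 0 ℚᵘ.* mkℚᵘ (+ b) 0} (*≡* (cong (ℤ._* + 1) (ℤ.pos-* a b))))
                (sym (fromℚᵘ-* (mkℚᵘ (+ a) 0) (mkℚᵘ (+ b) 0)))

/-as-* : ∀ a T .{{_ : NonZero T}} → (+ a) / T ≡ ι a ℚ.* ((+ 1) / T)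
/-as-* a (suc t) = trans (ℚ.fromℚᵘ-cong {mkℚᵘ (+ a) t} {mkℚᵘ (+ a) 0 ℚᵘ.* mkℚᵘ (+ 1) t}
                                        (*≡* (cong₂ ℤ._*_ (sym (ℤ.*-identityʳ (+ a))) (cong +_ (*-identityˡ (suc t))))))
                         (sym (fromℚᵘ-* (mkℚᵘ (+ a) 0) (mkℚᵘ (+ 1) t)))

/-cross : ∀ a b c d .{{_ : NonZero b}} .{{_ : NonZero d}} → a * d ≡ c * b → (+ a) / b ≡ (+ c) / d
/-cross a (suc s) c (suc t) ad≡cb = ℚ.fromℚᵘ-cong {mkℚᵘ (+ a) s} {mkℚᵘ (+ c) t}
  (*≡* (trans (sym (ℤ.pos-* a (suc t))) (trans (cong +_ ad≡cb) (ℤ.pos-* c (suc s)))))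

-- Σ< n f is qsum (upTo n) f; the lemmas below hold for any list of indices
qsum : List ℕ → (ℕ → ℚ) → ℚ
qsum xs f = foldr (λ p acc → f p ℚ.+ acc) 0ℚ xs

qsum-ext : ∀ xs {f g : ℕ → ℚ} → (∀ p → f p ≡ g p) → qsum xs f ≡ qsum xs g
qsum-ext []       eq = refl
qsum-ext (x ∷ xs) eq = cong₂ ℚ._+_ (eq x) (qsum-ext xs eq)

qsum-linear : ∀ xs (f g h : ℕ → ℚ) (a b : ℚ) →
  qsum xs (λ p → f p ℚ.+ (a ℚ.* g p ℚ.+ b ℚ.* h p)) ≡ qsum xs f ℚ.+ (a ℚ.* qsum xs g ℚ.+ b ℚ.* qsum xs h)
qsum-linear []       f g h a b = solve 2 (λ a b → con 0ℚ := con 0ℚ :+ (a :* con 0ℚ :+ b :* con 0ℚ)) refl a b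
qsum-linear (x ∷ xs) f g h a b = trans (cong (f x ℚ.+ (a ℚ.* g x ℚ.+ b ℚ.* h x) ℚ.+_) (qsum-linear xs f g h a b))
  (solve 8 (λ a b fx gx hx F G H → (fx :+ (a :* gx :+ b :* hx)) :+ (F :+ (a :* G :+ b :* H))
                                 := (fx :+ F) :+ (a :* (gx :+ G) :+ b :* (hx :+ H))) refl
     a b (f x) (g x) (h x) (qsum xs f) (qsum xs g) (qsum xs h))

qsum-fractions : ∀ xs (a c : ℕ → ℕ) T .{{_ : NonZero T}} →
  qsum xs (λ p → ι (a p) ℚ.* ((+ c p) / T)) ≡ (+ sumOver xs (λ p → a p * c p)) / T
qsum-fractions []       a c T = sym (ℚ.0/n≡0 T)
qsum-fractions (x ∷ xs) a c T = begin
  ι (a x) ℚ.* ((+ c x) / T) ℚ.+ qsum xs (λ p → ι (a p) ℚ.* ((+ c p) / T))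
    ≡⟨ cong₂ (λ u v → ι (a x) ℚ.* u ℚ.+ v) (/-as-* (c x) T) (trans (qsum-fractions xs a c T) (/-as-* s T)) ⟩
  ι (a x) ℚ.* (ι (c x) ℚ.* u) ℚ.+ ι s ℚ.* u
    ≡⟨ solve 4 (λ A C U S → A :* (C :* U) :+ S :* U := (A :* C :+ S) :* U) refl (ι (a x)) (ι (c x)) u (ι s) ⟩
  (ι (a x) ℚ.* ι (c x) ℚ.+ ι s) ℚ.* u
    ≡⟨ cong (ℚ._* u) (trans (ι-+ (a x * c x) s) (cong (ℚ._+ ι s) (ι-* (a x) (c x)))) ⟨
  ι (a x * c x + s) ℚ.* u
    ≡⟨ /-as-* (a x * c x + s) T ⟨
  (+ (a x * c x + s)) / T
    ∎
  where
  s = sumOver xs (λ p → a p * c p)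
  u = (+ 1) / T

total-nonZero : ∀ k → NonZero (total (suc k))
total-nonZero k = m*n≢0 (suc k) ((2 * suc k ∸ 1) !!) {{_}} {{dfact≢0 (2 * suc k ∸ 1)}}

moment : ∀ k m → Σ< (suc k) (λ p → ff p m ℚ.* 𝒞 (suc k) p) ≡ (+ (k P m)) / (suc m * suc (2 * m))
moment k m = trans (qsum-fractions (upTo (suc k)) (_P m) (C (suc k)) (total (suc k)) {{total-nonZero k}})
                   (/-cross S (total (suc k)) (k P m) c {{total-nonZero k}} cross)
  where
  S = sumOver (upTo (suc k)) (λ p → (p P m) * C (suc k) p)
  c = suc m * suc (2 * m)
  cross : S * c ≡ (k P m) * total (suc k)
  cross = trans (*-comm S c) (trans (momentIdentity k m) (*-comm (total (suc k)) (k P m)))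

mean-value : ∀ k → mean (suc k) ≡ (+ k) / 6
mean-value k = begin
  mean (suc k)                                  ≡⟨ qsum-ext (upTo (suc k)) (λ p → cong (λ a → ι a ℚ.* 𝒞 (suc k) p) (nP1≡n p)) ⟨
  Σ< (suc k) (λ p → ff p 1 ℚ.* 𝒞 (suc k) p)     ≡⟨ moment k 1 ⟩
  (+ (k P 1)) / 6                               ≡⟨ cong (λ a → (+ a) / 6) (nP1≡n k) ⟩
  (+ k) / 6                                     ∎

square≡fall2 : ∀ p → p * p ≡ p P 2 + p
square≡fall2 p = trans (square≡fall p) (cong (_+ p) (sym (P≡fall p 2)))
  where
  square≡fall : ∀ p → p * p ≡ fall p 2 + p
  square≡fall zero    = refl
  square≡fall (suc q) = trans (expand q) (cong (λ u → suc q * u + suc q) (sym (fall-one q)))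
    where
    expand : ∀ q → suc q * suc q ≡ suc q * q + suc q
    expand = solve-∀
    fall-one : ∀ q → fall q 1 ≡ q
    fall-one zero    = refl
    fall-one (suc q) = *-identityʳ (suc q)

ι-square : ∀ p → ι p ℚ.* ι p ≡ ff p 2 ℚ.+ ι p
ι-square p = trans (sym (ι-* p p)) (trans (cong ι (square≡fall2 p)) (ι-+ (p P 2) p))

centred-square : ∀ p μ w → (ι p ℚ.- μ) ℚ.* (ι p ℚ.- μ) ℚ.* w
                           ≡ ff p 2 ℚ.* w ℚ.+ ((1ℚ ℚ.- (μ ℚ.+ μ)) ℚ.* (ff p 1 ℚ.* w) ℚ.+ (μ ℚ.* μ) ℚ.* (ff p 0 ℚ.* w))
centred-square p μ w = begin
  (K ℚ.- μ) ℚ.* (K ℚ.- μ) ℚ.* w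
    ≡⟨ solve 3 (λ K μ w → (K :- μ) :* (K :- μ) :* w
                         := (K :* K) :* w :+ (con 1ℚ :- (μ :+ μ)) :* (K :* w) :+ (μ :* μ) :* w :- K :* w) refl K μ w ⟩
  (K ℚ.* K) ℚ.* w ℚ.+ (1ℚ ℚ.- (μ ℚ.+ μ)) ℚ.* (K ℚ.* w) ℚ.+ (μ ℚ.* μ) ℚ.* w ℚ.- K ℚ.* w
    ≡⟨ cong (λ u → u ℚ.* w ℚ.+ (1ℚ ℚ.- (μ ℚ.+ μ)) ℚ.* (K ℚ.* w) ℚ.+ (μ ℚ.* μ) ℚ.* w ℚ.- K ℚ.* w) (ι-square p) ⟩
  (Y ℚ.+ K) ℚ.* w ℚ.+ (1ℚ ℚ.- (μ ℚ.+ μ)) ℚ.* (K ℚ.* w) ℚ.+ (μ ℚ.* μ) ℚ.* w ℚ.- K ℚ.* w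
    ≡⟨ solve 4 (λ Y K μ w → (Y :+ K) :* w :+ (con 1ℚ :- (μ :+ μ)) :* (K :* w) :+ (μ :* μ) :* w :- K :* w
                           := Y :* w :+ ((con 1ℚ :- (μ :+ μ)) :* (K :* w) :+ (μ :* μ) :* (con 1ℚ :* w))) refl Y K μ w ⟩
  Y ℚ.* w ℚ.+ ((1ℚ ℚ.- (μ ℚ.+ μ)) ℚ.* (K ℚ.* w) ℚ.+ (μ ℚ.* μ) ℚ.* (1ℚ ℚ.* w))
    ≡⟨ cong (λ u → Y ℚ.* w ℚ.+ ((1ℚ ℚ.- (μ ℚ.+ μ)) ℚ.* (ι u ℚ.* w) ℚ.+ (μ ℚ.* μ) ℚ.* (1ℚ ℚ.* w))) (nP1≡n p) ⟨
  ff p 2 ℚ.* w ℚ.+ ((1ℚ ℚ.- (μ ℚ.+ μ)) ℚ.* (ff p 1 ℚ.* w) ℚ.+ (μ ℚ.* μ) ℚ.* (ff p 0 ℚ.* w))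
    ∎
  where
  K = ι p
  Y = ff p 2

variance-arithmetic : ∀ k → let μ = (+ k) / 6 in
  (+ (k P 2)) / 15 ℚ.+ ((1ℚ ℚ.- (μ ℚ.+ μ)) ℚ.* μ ℚ.+ (μ ℚ.* μ) ℚ.* 1ℚ) ≡ (+ (k * (7 * suc k + 11))) / 180
variance-arithmetic k = begin
  (+ (k P 2)) / 15 ℚ.+ ((1ℚ ℚ.- (μ ℚ.+ μ)) ℚ.* μ ℚ.+ (μ ℚ.* μ) ℚ.* 1ℚ)
    ≡⟨ cong₂ (λ u v → u ℚ.+ ((1ℚ ℚ.- (v ℚ.+ v)) ℚ.* v ℚ.+ (v ℚ.* v) ℚ.* 1ℚ)) (/-as-* (k P 2) 15) (/-as-* k 6) ⟩
  Y ℚ.* c15 ℚ.+ ((1ℚ ℚ.- (K ℚ.* c6 ℚ.+ K ℚ.* c6)) ℚ.* (K ℚ.* c6) ℚ.+ (K ℚ.* c6 ℚ.* (K ℚ.* c6)) ℚ.* 1ℚ)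
    ≡⟨ solve 4 (λ Y K c15 c6 → Y :* c15 :+ ((con 1ℚ :- (K :* c6 :+ K :* c6)) :* (K :* c6) :+ (K :* c6 :* (K :* c6)) :* con 1ℚ)
                             := Y :* c15 :+ K :* c6 :- (K :* K) :* (c6 :* c6)) refl Y K c15 c6 ⟩
  Y ℚ.* c15 ℚ.+ K ℚ.* c6 ℚ.- (K ℚ.* K) ℚ.* (c6 ℚ.* c6)
    ≡⟨ cong (λ u → Y ℚ.* c15 ℚ.+ K ℚ.* c6 ℚ.- u ℚ.* (c6 ℚ.* c6)) (ι-square k) ⟩
  Y ℚ.* c15 ℚ.+ K ℚ.* c6 ℚ.- (Y ℚ.+ K) ℚ.* (c6 ℚ.* c6)
    ≡⟨ solve 2 (λ Y K → Y :* con c15 :+ K :* con c6 :- (Y :+ K) :* (con c6 :* con c6)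
                     := (con (ι 7) :* Y :+ con (ι 25) :* K) :* con c180) refl Y K ⟩
  (ι 7 ℚ.* Y ℚ.+ ι 25 ℚ.* K) ℚ.* c180
    ≡⟨ cong (ℚ._* c180) (trans (ι-+ (7 * (k P 2)) (25 * k)) (cong₂ ℚ._+_ (ι-* 7 (k P 2)) (ι-* 25 k))) ⟨
  ι (7 * (k P 2) + 25 * k) ℚ.* c180
    ≡⟨ cong (λ u → ι u ℚ.* c180) polynomial ⟨
  ι (k * (7 * suc k + 11)) ℚ.* c180
    ≡⟨ /-as-* (k * (7 * suc k + 11)) 180 ⟨
  (+ (k * (7 * suc k + 11))) / 180
    ∎
  where
  μ = (+ k) / 6
  K = ι k
  Y = ff k 2
  c15 = (+ 1) / 15
  c6 = (+ 1) / 6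
  c180 = (+ 1) / 180
  polynomial : k * (7 * suc k + 11) ≡ 7 * (k P 2) + 25 * k
  polynomial = begin
    k * (7 * suc k + 11)       ≡⟨ expand k ⟩
    7 * (k * k) + 18 * k       ≡⟨ cong (λ u → 7 * u + 18 * k) (square≡fall2 k) ⟩
    7 * (k P 2 + k) + 18 * k   ≡⟨ collect (k P 2) k ⟩
    7 * (k P 2) + 25 * k       ∎
    where
    expand : ∀ k → k * (7 * suc k + 11) ≡ 7 * (k * k) + 18 * k
    expand = solve-∀
    collect : ∀ a k → 7 * (a + k) + 18 * k ≡ 7 * a + 25 * k
    collect = solve-∀

-- Var(C) = (n-1)(7n+11)/180: expand the square into factorial moments
variance-value : ∀ k → variance (suc k) ≡ (+ (k * (7 * suc k + 11))) / 180
variance-value k = begin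
  variance (suc k)
    ≡⟨ qsum-ext (upTo (suc k)) (λ p → centred-square p μ (𝒞 (suc k) p)) ⟩
  qsum (upTo (suc k)) (λ p → M 2 p ℚ.+ (α ℚ.* M 1 p ℚ.+ β ℚ.* M 0 p))
    ≡⟨ qsum-linear (upTo (suc k)) (M 2) (M 1) (M 0) α β ⟩
  Σ< (suc k) (M 2) ℚ.+ (α ℚ.* Σ< (suc k) (M 1) ℚ.+ β ℚ.* Σ< (suc k) (M 0))
    ≡⟨ cong₂ (λ u v → u ℚ.+ (α ℚ.* v ℚ.+ β ℚ.* Σ< (suc k) (M 0)))
             (moment k 2) (trans (moment k 1) (cong (λ a → (+ a) / 6) (nP1≡n k))) ⟩
  (+ (k P 2)) / 15 ℚ.+ (α ℚ.* ((+ k) / 6) ℚ.+ β ℚ.* Σ< (suc k) (M 0))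
    ≡⟨ cong (λ v → (+ (k P 2)) / 15 ℚ.+ (α ℚ.* ((+ k) / 6) ℚ.+ β ℚ.* v)) (moment k 0) ⟩
  (+ (k P 2)) / 15 ℚ.+ (α ℚ.* ((+ k) / 6) ℚ.+ β ℚ.* 1ℚ)
    ≡⟨ cong (λ μ′ → (+ (k P 2)) / 15 ℚ.+ ((1ℚ ℚ.- (μ′ ℚ.+ μ′)) ℚ.* ((+ k) / 6) ℚ.+ (μ′ ℚ.* μ′) ℚ.* 1ℚ)) (mean-value k) ⟩
  (+ (k P 2)) / 15 ℚ.+ ((1ℚ ℚ.- ((+ k) / 6 ℚ.+ (+ k) / 6)) ℚ.* ((+ k) / 6) ℚ.+ ((+ k) / 6 ℚ.* ((+ k) / 6)) ℚ.* 1ℚ)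
    ≡⟨ variance-arithmetic k ⟩
  (+ (k * (7 * suc k + 11))) / 180
    ∎
  where
  μ = mean (suc k)
  α = 1ℚ ℚ.- (μ ℚ.+ μ)
  β = μ ℚ.* μ
  M : ℕ → ℕ → ℚ
  M j p = ff p j ℚ.* 𝒞 (suc k) p

lemma14 : (n : ℕ) → .{{_ : NonZero n}} →
    ((m : ℕ) → Σ< n (λ p → ff p m ℚ.* 𝒞 n p)
    ≡ (+ ((n ∸ 1) P m)) / (suc m ℕ.* suc (2 ℕ.* m)))
    × (mean n ≡ (+ (n ∸ 1)) / 6)
    × (variance n ≡ (+ ((n ∸ 1) ℕ.* (7 ℕ.* n ℕ.+ 11))) / 180)
lemma14 (suc k) = moment k , mean-value k , variance-value k
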